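{- For a positive integer $p$ with $p\geq 10^3$, let the graph $K$ arise from the complete graph $K_{2p}$ by removing up to $0.01\binom{p}{2}$ edges in such a way that $K$ has a perfect matching. Then $K$ has at least $\lceil 0.447p\rceil!$ perfect matchings. -}

module Defs where

open import Data.Nat using (ℕ; _+_; _*_; _/_; _<ᵇ_; _≤_; _!)
open import Data.Nat.Combinatorics using (_C_)
open import Data.Bool using (Bool; true; false; not; _∧_; if_then_else_)
open import Data.Fin using (Fin; toℕ)
open import Data.List using (List; map; allFin)
open import Data.Nat.ListAction using (sum)
open import Data.Product using (Σ)
open import Relation.Binary.PropositionalEquality using (_≡_; _≢_)
open import Relation.Nullary using (¬_)

record Graph (n : ℕ) : Set where
  field
    adj    : Fin n → Fin n → Bool
    sym    : ∀ i j → adj i j ≡ adj j i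
    irrefl : ∀ i → adj i i ≡ false
open Graph public

missingEdges : ∀ {n} → Graph n → ℕ
missingEdges {n} G =
  sum (map (λ i → sum (map (λ j →
         if (toℕ i <ᵇ toℕ j) ∧ not (adj G i j) then 1 else 0)
       (allFin n))) (allFin n))

-- A perfect matching of G, encoded as the fixed-point-free involution
-- sending each vertex to its partner, along an edge of G.
record PerfectMatching {n : ℕ} (G : Graph n) : Set where
  field
    partner : Fin n → Fin n
    invol   : ∀ i → partner (partner i) ≡ i
    noFix   : ∀ i → partner i ≢ i
    isEdge  : ∀ i → adj G i (partner i) ≡ true
open PerfectMatching public

SameMatching : ∀ {n} {G : Graph n} → PerfectMatching G → PerfectMatching G → Set
SameMatching M M' = ∀ i → partner M i ≡ partner M' i

AtLeastMatchings : ∀ {n} → Graph n → ℕ → Set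
AtLeastMatchings G N =
  Σ (Fin N → PerfectMatching G) λ f → ∀ a b → SameMatching (f a) (f b) → a ≡ b

-- ⌈ 0.447 p ⌉ = ⌈ 447 p / 1000 ⌉
ceil0447 : ℕ → ℕ
ceil0447 p = (447 * p + 999) / 1000

{-# OPTIONS --safe #-}

-- Fix a perfect matching M with partner map P, and let L list one endpoint of each of some
-- edges of M whose two endpoints have at most s non-neighbours in total. Add these edges one
-- at a time. Given r! matchings that agree with M off the edges already added, each of them,
-- say N, still contains the next edge {z, P z}, which may be kept or switched together with
-- an earlier edge {a, N a} into {a, P z} and {N a, z}. The switch needs a ~ P z and N a ~ z,
-- which fails for at most s earlier vertices a; so while r + s is at most the number of
-- earlier edges, every N has r + 1 extensions, and since a switch can be undone the (r + 1)!
-- results are distinct. Take s = 2⌊p/10⌋: the non-degrees sum to at most twice the number of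
-- missing edges plus 2p, so by Markov's inequality few vertices have more than p/10
-- non-neighbours, leaving at least ⌈0.447p⌉ + s edges of M with both endpoints below that.

module Submission where

open import Defs renaming (sym to adj-sym)
open import Data.Bool using (Bool; true; false; not; _∧_; if_then_else_)
open import Data.Bool.Properties using (¬-not) renaming (_≟_ to _≟ᵇ_)
open import Data.Fin using (Fin; zero; suc; toℕ; inject≤; combine; remQuot; _≟_)
open import Data.Fin.Permutation using (Permutation′; _⟨$⟩ʳ_; _⟨$⟩ˡ_; inverseˡ; inverseʳ; transpose)
import Data.Fin.Permutation.Components as PC
open import Data.Fin.Properties using (injective⇒≤; inject≤-injective; <-cmp; toℕ-injective; combine-remQuot)
open import Data.List using (List; []; _∷_; length; lookup; filter; map; allFin)
open import Data.List.Properties using (length-tabulate)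
open import Data.List.Membership.Propositional using (_∈_; _∉_)
open import Data.List.Membership.Propositional.Properties using (∈-lookup; ∈-filter⁻; ∈-filter⁺; ∈-allFin)
import Data.List.Relation.Unary.All as All
open import Data.List.Relation.Unary.Any using (index; here; there)
open import Data.List.Relation.Unary.Any.Properties using (lookup-index)
import Data.List.Relation.Unary.AllPairs as AllPairs
open AllPairs using (_∷_)
open import Data.List.Relation.Unary.Unique.Propositional using (Unique)
open import Data.List.Relation.Unary.Unique.Propositional.Properties using (allFin⁺; filter⁺; Unique[x∷xs]⇒x∉xs)
open import Data.Nat
  using (ℕ; zero; suc; _+_; _*_; _≤_; _<_; _≤?_; _<?_; _<ᵇ_; _/_; _%_; _!; z≤n; s≤s; NonZero; >-nonZero)
open import Data.Nat.Combinatorics using (_C_; nC1≡n; nCk+nC[k+1]≡[n+1]C[k+1])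
open import Data.Nat.DivMod using (m≡m%n+[m/n]*n; m%n<n; m/n*n≤m)
open import Data.Nat.ListAction using (sum)
open import Data.Nat.Properties hiding (_≟_; <-cmp)
open import Algebra.Properties.CommutativeSemigroup +-commutativeSemigroup using () renaming (interchange to +-interchange)
open import Data.Nat.Tactic.RingSolver using (solve-∀)
open import Data.Product using (Σ; _,_; _×_; proj₁; proj₂; uncurry)
open import Function using (id; _∘_)
open import Relation.Binary.Definitions using (tri<; tri≈; tri>)
open import Relation.Binary.PropositionalEquality
open import Relation.Nullary using (¬_; ¬?; Dec; does; yes; no; _×-dec_; contradiction)
open import Relation.Nullary.Decidable using (dec-true; dec-false)
open import Relation.Unary using (Pred; Decidable)
open import Relation.Unary.Properties using (∁?; _∩?_)

-- Counting in lists

private variable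
  A B : Set
  xs ys : List A
  n : ℕ

lookup-injective : Unique xs → ∀ {i j} → lookup xs i ≡ lookup xs j → i ≡ j
lookup-injective (_ ∷ _) {zero} {zero} _ = refl
lookup-injective (x≢xs ∷ _) {zero} {suc j} eq = contradiction eq (All.lookup x≢xs (∈-lookup j))
lookup-injective (x≢xs ∷ _) {suc i} {zero} eq = contradiction (sym eq) (All.lookup x≢xs (∈-lookup i))
lookup-injective (_ ∷ u) {suc i} {suc j} eq = cong suc (lookup-injective u eq)

Unique-injection⇒length≤ : {ys : List B} (f : A → B) → (∀ {x y} → f x ≡ f y → x ≡ y) →
                           Unique xs → (∀ {x} → x ∈ xs → f x ∈ ys) → length xs ≤ length ys
Unique-injection⇒length≤ {xs = xs} {ys = ys} f f-injective u f∈ys = injective⇒≤ position-injective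
  where
  position : Fin (length xs) → Fin (length ys)
  position i = index (f∈ys (∈-lookup i))
  position-injective : ∀ {i j} → position i ≡ position j → i ≡ j
  position-injective {i} {j} eq = lookup-injective u (f-injective (begin
    f (lookup xs i)          ≡⟨ lookup-index (f∈ys (∈-lookup i)) ⟩
    lookup ys (position i)   ≡⟨ cong (lookup ys) eq ⟩
    lookup ys (position j)   ≡⟨ lookup-index (f∈ys (∈-lookup j)) ⟨
    f (lookup xs j)          ∎))
    where open ≡-Reasoning

module _ {p} {P : Pred A p} (P? : Decidable P) where

  length-filter+length-filter-∁ : ∀ xs → length (filter P? xs) + length (filter (∁? P?) xs) ≡ length xs
  length-filter+length-filter-∁ [] = refl
  length-filter+length-filter-∁ (x ∷ xs) with does (P? x)
  ... | true  = cong suc (length-filter+length-filter-∁ xs)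
  ... | false = trans (+-suc _ _) (cong suc (length-filter+length-filter-∁ xs))

  length-filter*≤sum : (f : A → ℕ) {t : ℕ} → (∀ {x} → P x → t ≤ f x) → ∀ xs →
                       length (filter P? xs) * t ≤ sum (map f xs)
  length-filter*≤sum f P⇒t≤f [] = z≤n
  length-filter*≤sum f P⇒t≤f (x ∷ xs) with P? x
  ... | yes Px = +-mono-≤ (P⇒t≤f Px) (length-filter*≤sum f P⇒t≤f xs)
  ... | no _   = ≤-trans (length-filter*≤sum f P⇒t≤f xs) (m≤n+m _ _)

module _ {p q} {P : Pred A p} {Q : Pred A q} (P? : Decidable P) (Q? : Decidable Q) where

  private
    #P∩Q #∁P #∁Q : List A → ℕ
    #P∩Q xs = length (filter (P? ∩? Q?) xs)
    #∁P  xs = length (filter (∁? P?) xs)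
    #∁Q  xs = length (filter (∁? Q?) xs)

  length≤filter-∩+filter-∁+filter-∁ : ∀ xs →
    length xs ≤ length (filter (P? ∩? Q?) xs) + length (filter (∁? P?) xs) + length (filter (∁? Q?) xs)
  length≤filter-∩+filter-∁+filter-∁ [] = z≤n
  length≤filter-∩+filter-∁+filter-∁ (x ∷ xs)
    with ih ← length≤filter-∩+filter-∁+filter-∁ xs | does (P? x) | does (Q? x)
  ... | true  | true  = s≤s ih
  ... | true  | false = ≤-trans (s≤s ih) (≤-reflexive (sym (+-suc (#P∩Q xs + #∁P xs) (#∁Q xs))))
  ... | false | true  = ≤-trans (s≤s ih) (≤-reflexive (cong (_+ #∁Q xs) (sym (+-suc (#P∩Q xs) (#∁P xs)))))
  ... | false | false = ≤-trans (s≤s ih) (≤-trans (n≤1+n _) (≤-reflexive (begin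
    suc (suc (#P∩Q xs + #∁P xs + #∁Q xs))   ≡⟨ cong suc (+-suc (#P∩Q xs + #∁P xs) (#∁Q xs)) ⟨
    suc (#P∩Q xs + #∁P xs + suc (#∁Q xs))   ≡⟨ cong (_+ suc (#∁Q xs)) (+-suc (#P∩Q xs) (#∁P xs)) ⟨
    #P∩Q xs + suc (#∁P xs) + suc (#∁Q xs)   ∎)))
    where open ≡-Reasoning

module _ (xs : List A) {r} (r≤ : r ≤ length xs) where

  pick : Fin r → A
  pick i = lookup xs (inject≤ i r≤)

  pick-∈ : ∀ i → pick i ∈ xs
  pick-∈ i = ∈-lookup (inject≤ i r≤)

  pick-injective : Unique xs → ∀ {i j} → pick i ≡ pick j → i ≡ j
  pick-injective u eq = inject≤-injective r≤ r≤ _ _ (lookup-injective u eq)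

indicator : Bool → ℕ
indicator b = if b then 1 else 0

module _ {p} {P : Pred A p} (P? : Decidable P) where

  length-filter≡sum-indicator : ∀ xs → length (filter P? xs) ≡ sum (map (indicator ∘ does ∘ P?) xs)
  length-filter≡sum-indicator [] = refl
  length-filter≡sum-indicator (x ∷ xs) with does (P? x)
  ... | true  = cong suc (length-filter≡sum-indicator xs)
  ... | false = length-filter≡sum-indicator xs

sum-map-mono-≤ : {f g : A → ℕ} → (∀ x → f x ≤ g x) → ∀ xs → sum (map f xs) ≤ sum (map g xs)
sum-map-mono-≤ f≤g []       = z≤n
sum-map-mono-≤ f≤g (x ∷ xs) = +-mono-≤ (f≤g x) (sum-map-mono-≤ f≤g xs)

sum-map-+ : (f g : A → ℕ) → ∀ xs → sum (map (λ x → f x + g x) xs) ≡ sum (map f xs) + sum (map g xs)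
sum-map-+ f g []       = refl
sum-map-+ f g (x ∷ xs) = trans (cong (f x + g x +_) (sum-map-+ f g xs)) (+-interchange (f x) (g x) _ _)

sum-map-const : ∀ c (xs : List A) → sum (map (λ _ → c) xs) ≡ length xs * c
sum-map-const c []       = refl
sum-map-const c (x ∷ xs) = cong (c +_) (sum-map-const c xs)

sum-map-comm : (f : A → B → ℕ) → ∀ xs ys →
  sum (map (λ x → sum (map (f x) ys)) xs) ≡ sum (map (λ y → sum (map (λ x → f x y) xs)) ys)
sum-map-comm f []       ys = sym (trans (sum-map-const 0 ys) (*-zeroʳ (length ys)))
sum-map-comm f (x ∷ xs) ys = begin
  sum (map (f x) ys) + sum (map (λ x → sum (map (f x) ys)) xs)
    ≡⟨ cong (sum (map (f x) ys) +_) (sum-map-comm f xs ys) ⟩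
  sum (map (f x) ys) + sum (map (λ y → sum (map (λ x → f x y) xs)) ys)
    ≡⟨ sum-map-+ (f x) (λ y → sum (map (λ x → f x y) xs)) ys ⟨
  sum (map (λ y → f x y + sum (map (λ x → f x y) xs)) ys) ∎
  where open ≡-Reasoning

-- Non-neighbours and missing edges

module _ {n : ℕ} (K : Graph n) where

  Adjacent : Fin n → Fin n → Set
  Adjacent u v = adj K u v ≡ true

  adjacent? : ∀ u v → Dec (Adjacent u v)
  adjacent? u v = adj K u v ≟ᵇ true

  -- Contains v itself, as adj is irreflexive.
  nonNeighbours : Fin n → List (Fin n)
  nonNeighbours v = filter (∁? (adjacent? v)) (allFin n)

  nonDegree : Fin n → ℕ
  nonDegree v = length (nonNeighbours v)

  -- missingEdges K is ∑ (λ i → ∑ (missing i)) by definition.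
  missing : Fin n → Fin n → ℕ
  missing i j = indicator ((toℕ i <ᵇ toℕ j) ∧ not (adj K i j))

  missing≡1 : ∀ {i j} → toℕ i < toℕ j → ¬ Adjacent i j → missing i j ≡ 1
  missing≡1 {i} {j} i<j ¬ij rewrite dec-true (toℕ i <? toℕ j) i<j | ¬-not ¬ij = refl

  nonAdjacent≤missing : ∀ v u →
    indicator (not (does (adjacent? v u))) ≤ missing v u + missing u v + indicator (does (v ≟ u))
  nonAdjacent≤missing v u with adjacent? v u | <-cmp v u
  ... | yes _   | _ = z≤n
  ... | no ¬vu | tri< v<u _ _ = begin
    1                                        ≡⟨ missing≡1 v<u ¬vu ⟨
    missing v u                              ≤⟨ m≤m+n _ _ ⟩
    missing v u + missing u v                ≤⟨ m≤m+n _ _ ⟩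
    missing v u + missing u v + indicator _  ∎
    where open ≤-Reasoning
  ... | no ¬vu | tri> _ _ u<v = begin
    1                                        ≡⟨ missing≡1 u<v (¬vu ∘ trans (adj-sym K v u)) ⟨
    missing u v                              ≤⟨ m≤n+m _ _ ⟩
    missing v u + missing u v                ≤⟨ m≤m+n _ _ ⟩
    missing v u + missing u v + indicator _  ∎
    where open ≤-Reasoning
  ... | no _   | tri≈ _ refl _ rewrite dec-true (v ≟ v) refl = m≤n+m 1 _

  ∑ : (Fin n → ℕ) → ℕ
  ∑ f = sum (map f (allFin n))

  ∑-diagonal≤1 : ∀ v → ∑ (λ u → indicator (does (v ≟ u))) ≤ 1
  ∑-diagonal≤1 v = begin
    ∑ (λ u → indicator (does (v ≟ u)))  ≡⟨ length-filter≡sum-indicator (v ≟_) (allFin n) ⟨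
    length (filter (v ≟_) (allFin n))   ≤⟨ Unique-injection⇒length≤ id id (filter⁺ (v ≟_) {allFin n} (allFin⁺ n)) only-v ⟩
    length (v ∷ [])                     ∎
    where
    open ≤-Reasoning
    only-v : ∀ {u} → u ∈ filter (v ≟_) (allFin n) → u ∈ v ∷ []
    only-v u∈ = here (sym (proj₂ (∈-filter⁻ (v ≟_) {xs = allFin n} u∈)))

  nonDegree≤ : ∀ v → nonDegree v ≤ ∑ (missing v) + ∑ (λ u → missing u v) + 1
  nonDegree≤ v = begin
    nonDegree v
      ≡⟨ length-filter≡sum-indicator (∁? (adjacent? v)) (allFin n) ⟩
    ∑ (λ u → indicator (not (does (adjacent? v u))))
      ≤⟨ sum-map-mono-≤ (nonAdjacent≤missing v) (allFin n) ⟩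
    ∑ (λ u → missing v u + missing u v + indicator (does (v ≟ u)))
      ≡⟨ sum-map-+ _ _ (allFin n) ⟩
    ∑ (λ u → missing v u + missing u v) + ∑ (λ u → indicator (does (v ≟ u)))
      ≡⟨ cong (_+ _) (sum-map-+ _ _ (allFin n)) ⟩
    ∑ (missing v) + ∑ (λ u → missing u v) + ∑ (λ u → indicator (does (v ≟ u)))
      ≤⟨ +-monoʳ-≤ _ (∑-diagonal≤1 v) ⟩
    ∑ (missing v) + ∑ (λ u → missing u v) + 1 ∎
    where open ≤-Reasoning

  ∑-nonDegree≤ : ∑ nonDegree ≤ missingEdges K + missingEdges K + n
  ∑-nonDegree≤ = begin
    ∑ nonDegree
      ≤⟨ sum-map-mono-≤ nonDegree≤ (allFin n) ⟩
    ∑ (λ v → ∑ (missing v) + ∑ (λ u → missing u v) + 1)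
      ≡⟨ sum-map-+ _ _ (allFin n) ⟩
    ∑ (λ v → ∑ (missing v) + ∑ (λ u → missing u v)) + ∑ (λ _ → 1)
      ≡⟨ cong₂ _+_ (sum-map-+ _ _ (allFin n)) (sum-map-const 1 (allFin n)) ⟩
    missingEdges K + ∑ (λ v → ∑ (λ u → missing u v)) + length (allFin n) * 1
      ≡⟨ cong₂ (λ a b → missingEdges K + a + b) (sum-map-comm (λ v u → missing u v) (allFin n) (allFin n))
               (trans (*-identityʳ _) (length-tabulate _)) ⟩
    missingEdges K + missingEdges K + n ∎
    where open ≤-Reasoning

  nonAdjacent-count≤nonDegree : {f : Fin n → Fin n} → (∀ {x y} → f x ≡ f y → x ≡ y) →
    ∀ v {L} → Unique L → length (filter (λ a → ¬? (adjacent? (f a) v)) L) ≤ nonDegree v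
  nonAdjacent-count≤nonDegree {f} f-injective v {L} uL =
    Unique-injection⇒length≤ f f-injective (filter⁺ _ uL) f∈nonNeighbours
    where
    f∈nonNeighbours : ∀ {a} → a ∈ filter (λ a → ¬? (adjacent? (f a) v)) L → f a ∈ nonNeighbours v
    f∈nonNeighbours {a} a∈ =
      ∈-filter⁺ (∁? (adjacent? v)) (∈-allFin (f a)) (proj₂ (∈-filter⁻ _ {xs = L} a∈) ∘ trans (adj-sym K (f a) v))

-- Switching a perfect matching

transpose-matchˡ : (i j : Fin n) → PC.transpose i j i ≡ j
transpose-matchˡ i j rewrite dec-true (i ≟ i) refl = refl

transpose-matchʳ : (i j : Fin n) → PC.transpose i j j ≡ i
transpose-matchʳ i j with j ≟ i
... | yes j≡i = j≡i
... | no _ rewrite dec-true (j ≟ j) refl = refl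

transpose-fixed : {i j k : Fin n} → k ≢ i → k ≢ j → PC.transpose i j k ≡ k
transpose-fixed {i = i} {j} {k} k≢i k≢j rewrite dec-false (k ≟ i) k≢i | dec-false (k ≟ j) k≢j = refl

module _ {K : Graph n} where

  partner-injective : (N : PerfectMatching K) → ∀ {x y} → partner N x ≡ partner N y → x ≡ y
  partner-injective N {x} {y} eq = begin
    x                      ≡⟨ invol N x ⟨
    partner N (partner N x) ≡⟨ cong (partner N) eq ⟩
    partner N (partner N y) ≡⟨ invol N y ⟩
    y                      ∎
    where open ≡-Reasoning

  conjugate : (π : Permutation′ n) (N : PerfectMatching K) →
              (∀ v → Adjacent K (π ⟨$⟩ʳ v) (π ⟨$⟩ʳ partner N v)) → PerfectMatching K
  conjugate π N π-edges = record
    { partner = π-partner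
    ; invol   = π-invol
    ; noFix   = λ v fixed → noFix N (π ⟨$⟩ˡ v) (trans (sym (inverseˡ π)) (cong (π ⟨$⟩ˡ_) fixed))
    ; isEdge  = λ v → subst (λ w → Adjacent K w (π-partner v)) (inverseʳ π) (π-edges (π ⟨$⟩ˡ v))
    }
    where
    π-partner : Fin n → Fin n
    π-partner v = π ⟨$⟩ʳ partner N (π ⟨$⟩ˡ v)
    π-invol : ∀ v → π-partner (π-partner v) ≡ v
    π-invol v = begin
      π ⟨$⟩ʳ partner N (π ⟨$⟩ˡ (π ⟨$⟩ʳ partner N (π ⟨$⟩ˡ v)))  ≡⟨ cong (λ w → π ⟨$⟩ʳ partner N w) (inverseˡ π) ⟩
      π ⟨$⟩ʳ partner N (partner N (π ⟨$⟩ˡ v))                  ≡⟨ cong (π ⟨$⟩ʳ_) (invol N _) ⟩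
      π ⟨$⟩ʳ (π ⟨$⟩ˡ v)                                        ≡⟨ inverseʳ π ⟩
      v                                                        ∎
      where open ≡-Reasoning

  partner-conjugate⁻¹ : ∀ π N π-edges v → partner N v ≡ π ⟨$⟩ˡ partner (conjugate π N π-edges) (π ⟨$⟩ʳ v)
  partner-conjugate⁻¹ π N _ v = sym (trans (cong (λ w → π ⟨$⟩ˡ (π ⟨$⟩ʳ partner N w)) (inverseˡ π)) (inverseˡ π))

  unswitch : PerfectMatching K → Fin n → Fin n → Fin n → Fin n
  unswitch S b c v = PC.transpose (partner S c) b (partner S (PC.transpose b (partner S c) v))

  unswitch-cong : ∀ {S T} → SameMatching S T → ∀ b c v → unswitch S b c v ≡ unswitch T b c v
  unswitch-cong {T = T} S≈T b c v rewrite S≈T c =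
    cong (PC.transpose (partner T c) b) (S≈T (PC.transpose b (partner T c) v))

  -- Replaces the edges {a, Q a} and {b, Q b} of N (where Q = partner N) by {a, b} and {Q a, Q b}.
  module Switch (N : PerfectMatching K) {a b : Fin n} (a≢b : a ≢ b)
                (ab : Adjacent K a b) (QaQb : Adjacent K (partner N a) (partner N b)) where

    private
      Q = partner N
      σ = PC.transpose b (Q a)

      Qb≢Qa : Q b ≢ Q a
      Qb≢Qa = a≢b ∘ sym ∘ partner-injective N

      a≢Qa : a ≢ Q a
      a≢Qa = noFix N a ∘ sym

      σ-Qb : σ (Q b) ≡ Q b
      σ-Qb = transpose-fixed (noFix N b) Qb≢Qa

      σ-a : σ a ≡ a
      σ-a = transpose-fixed a≢b a≢Qa

      partner-swap : ∀ {w v} → Q w ≡ v → w ≡ Q v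
      partner-swap {w} Qw≡v = trans (sym (invol N w)) (cong Q Qw≡v)

      σ-edges : ∀ w → Adjacent K (σ w) (σ (Q w))
      -- Deciding b ≟ w rather than w ≟ b keeps with-abstraction out of the body of PC.transpose.
      σ-edges w with b ≟ w | Q a ≟ w | Q b ≟ w | a ≟ w
      ... | yes refl | _        | _        | _
        rewrite transpose-matchˡ b (Q a) | σ-Qb = QaQb
      ... | no _     | yes refl | _        | _
        rewrite transpose-matchʳ b (Q a) | invol N a | σ-a = trans (adj-sym K b a) ab
      ... | no _     | no _     | yes refl | _
        rewrite σ-Qb | invol N b | transpose-matchˡ b (Q a) = trans (adj-sym K (Q b) (Q a)) QaQb
      ... | no _     | no _     | no _     | yes refl
        rewrite σ-a | transpose-matchʳ b (Q a) = ab
      ... | no b≢w   | no Qa≢w  | no Qb≢w  | no a≢w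
        rewrite transpose-fixed (b≢w ∘ sym) (Qa≢w ∘ sym)
              | transpose-fixed (Qb≢w ∘ sym ∘ partner-swap) (a≢w ∘ sym ∘ partner-injective N)
        = isEdge N w

    switch : PerfectMatching K
    switch = conjugate (transpose b (Q a)) N σ-edges

    partner-switch-b : partner switch b ≡ a
    partner-switch-b rewrite transpose-matchʳ (Q a) b | invol N a = σ-a

    partner-switch-Qb : partner switch (Q b) ≡ Q a
    partner-switch-Qb rewrite transpose-fixed (Qb≢Qa) (noFix N b) | invol N b = transpose-matchˡ b (Q a)

    partner-switch-other : ∀ {v} → v ≢ b → v ≢ Q a → Q v ≢ b → Q v ≢ Q a → partner switch v ≡ Q v
    partner-switch-other v≢b v≢Qa Qv≢b Qv≢Qa
      rewrite transpose-fixed v≢Qa v≢b = transpose-fixed Qv≢b Qv≢Qa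

    partner-unswitch : ∀ v → Q v ≡ unswitch switch b (Q b) v
    partner-unswitch v rewrite partner-switch-Qb = partner-conjugate⁻¹ (transpose b (Q a)) N σ-edges v

-- Extending matchings along light edges of M

module _ {n : ℕ} {K : Graph n} (M : PerfectMatching K) where

  private
    P = partner M

  AgreesOutside : List (Fin n) → PerfectMatching K → Set
  AgreesOutside L N = ∀ v → v ∉ L → P v ∉ L → partner N v ≡ P v

  AgreeingMatchings : ℕ → List (Fin n) → Set
  AgreeingMatchings k L = Σ (AtLeastMatchings K k) λ F → ∀ i → AgreesOutside L (proj₁ F i)

  record LightEdges (t : ℕ) (L : List (Fin n)) : Set where
    field
      unique   : Unique L
      partner∉ : ∀ {z} → z ∈ L → P z ∉ L
      light    : ∀ {z} → z ∈ L → nonDegree K z + nonDegree K (P z) ≤ t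

  LightEdges-tail : ∀ {t z L} → LightEdges t (z ∷ L) → LightEdges t L
  LightEdges-tail E = record
    { unique   = AllPairs.tail (unique E)
    ; partner∉ = λ z∈ → partner∉ E (there z∈) ∘ there
    ; light    = light E ∘ there
    }
    where open LightEdges

  module Step {t z L} (z∉L : z ∉ L) (Pz∉L : P z ∉ L) (light : nonDegree K z + nonDegree K (P z) ≤ t)
              (uL : Unique L) {r} (r+t≤ : r + t ≤ length L) where

    module Extend (N : PerfectMatching K) (agrees : AgreesOutside L N) where

      private
        Q = partner N

      Q-Pz : Q (P z) ≡ z
      Q-Pz = trans (agrees (P z) Pz∉L (subst (_∉ L) (sym (invol M z)) z∉L)) (invol M z)

      candidates : List (Fin n)
      candidates = filter (λ a → adjacent? K a (P z) ×-dec adjacent? K (Q a) z) L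

      r≤candidates : r ≤ length candidates
      r≤candidates = +-cancelʳ-≤ t r (length candidates) (begin
        r + t
          ≤⟨ r+t≤ ⟩
        length L
          ≤⟨ length≤filter-∩+filter-∁+filter-∁ (λ a → adjacent? K a (P z)) (λ a → adjacent? K (Q a) z) L ⟩
        length candidates + length far-from-Pz + length Q-far-from-z
          ≤⟨ +-mono-≤ (+-monoʳ-≤ (length candidates) far-from-Pz≤) Q-far-from-z≤ ⟩
        length candidates + nonDegree K (P z) + nonDegree K z
          ≡⟨ +-assoc (length candidates) (nonDegree K (P z)) (nonDegree K z) ⟩
        length candidates + (nonDegree K (P z) + nonDegree K z)
          ≤⟨ +-monoʳ-≤ (length candidates) (≤-trans (≤-reflexive (+-comm (nonDegree K (P z)) (nonDegree K z))) light) ⟩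
        length candidates + t ∎)
        where
        open ≤-Reasoning
        far-from-Pz = filter (λ a → ¬? (adjacent? K a (P z))) L
        Q-far-from-z = filter (λ a → ¬? (adjacent? K (Q a) z)) L
        far-from-Pz≤ : length far-from-Pz ≤ nonDegree K (P z)
        far-from-Pz≤ = nonAdjacent-count≤nonDegree K id (P z) uL
        Q-far-from-z≤ : length Q-far-from-z ≤ nonDegree K z
        Q-far-from-z≤ = nonAdjacent-count≤nonDegree K (partner-injective N) z uL

      candidate : Fin r → Fin n
      candidate = pick candidates r≤candidates

      candidate-∈L : ∀ i → candidate i ∈ L
      candidate-∈L i = proj₁ (∈-filter⁻ _ {xs = L} (pick-∈ candidates r≤candidates i))

      candidate-switchable : ∀ i → Adjacent K (candidate i) (P z) × Adjacent K (Q (candidate i)) z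
      candidate-switchable i = proj₂ (∈-filter⁻ _ {xs = L} (pick-∈ candidates r≤candidates i))

      module _ (i : Fin r) where
        module S = Switch N (λ a≡Pz → Pz∉L (subst (_∈ L) a≡Pz (candidate-∈L i)))
                            (proj₁ (candidate-switchable i))
                            (subst (Adjacent K (Q (candidate i))) (sym Q-Pz) (proj₂ (candidate-switchable i)))

      extension : Fin (suc r) → PerfectMatching K
      extension zero    = N
      extension (suc i) = S.switch i

      extension-agrees : ∀ i → AgreesOutside (z ∷ L) (extension i)
      extension-agrees zero    v v∉ Pv∉ = agrees v (v∉ ∘ there) (Pv∉ ∘ there)
      extension-agrees (suc i) v v∉ Pv∉ = trans (S.partner-switch-other i v≢Pz v≢Qa Qv≢Pz Qv≢Qa) Qv≡Pv
        where
        Qv≡Pv : Q v ≡ P v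
        Qv≡Pv = agrees v (v∉ ∘ there) (Pv∉ ∘ there)
        v≢Pz : v ≢ P z
        v≢Pz v≡Pz = Pv∉ (here (trans (cong P v≡Pz) (invol M z)))
        v≢Qa : v ≢ Q (candidate i)
        v≢Qa v≡Qa = Pv∉ (there (subst (_∈ L) (trans (sym (invol N _)) (trans (cong Q (sym v≡Qa)) Qv≡Pv)) (candidate-∈L i)))
        Qv≢Pz : Q v ≢ P z
        Qv≢Pz Qv≡Pz = v∉ (here (partner-injective M (trans (sym Qv≡Pv) Qv≡Pz)))
        Qv≢Qa : Q v ≢ Q (candidate i)
        Qv≢Qa Qv≡Qa = v∉ (there (subst (_∈ L) (sym (partner-injective N Qv≡Qa)) (candidate-∈L i)))

    open Extend

    extension-zero≉suc : ∀ N₁ a₁ N₂ a₂ j → ¬ SameMatching (extension N₁ a₁ zero) (extension N₂ a₂ (suc j))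
    extension-zero≉suc N₁ a₁ N₂ a₂ j same = z∉L (subst (_∈ L) candidate≡z (candidate-∈L N₂ a₂ j))
      where
      candidate≡z : candidate N₂ a₂ j ≡ z
      candidate≡z = begin
        candidate N₂ a₂ j                         ≡⟨ S.partner-switch-b N₂ a₂ j ⟨
        partner (extension N₂ a₂ (suc j)) (P z)   ≡⟨ same (P z) ⟨
        partner N₁ (P z)                          ≡⟨ Q-Pz N₁ a₁ ⟩
        z                                         ∎
        where open ≡-Reasoning

    extension-injective : ∀ N a i j → SameMatching (extension N a i) (extension N a j) → i ≡ j
    extension-injective N a zero    zero    same = refl
    extension-injective N a zero    (suc j) same = contradiction same (extension-zero≉suc N a N a j)
    extension-injective N a (suc i) zero    same = contradiction (sym ∘ same) (extension-zero≉suc N a N a i)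
    extension-injective N a (suc i) (suc j) same =
      cong suc (pick-injective (candidates N a) (r≤candidates N a) (filter⁺ _ uL)
        (trans (sym (S.partner-switch-b N a i)) (trans (same (P z)) (S.partner-switch-b N a j))))

    extension-base : ∀ N₁ a₁ N₂ a₂ i j →
      SameMatching (extension N₁ a₁ i) (extension N₂ a₂ j) → SameMatching N₁ N₂
    extension-base N₁ a₁ N₂ a₂ zero    zero    same = same
    extension-base N₁ a₁ N₂ a₂ zero    (suc j) same = contradiction same (extension-zero≉suc N₁ a₁ N₂ a₂ j)
    extension-base N₁ a₁ N₂ a₂ (suc i) zero    same = contradiction (sym ∘ same) (extension-zero≉suc N₂ a₂ N₁ a₁ i)
    extension-base N₁ a₁ N₂ a₂ (suc i) (suc j) same v = begin
      partner N₁ v                         ≡⟨ S.partner-unswitch N₁ a₁ i v ⟩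
      unswitch S₁ (P z) (partner N₁ (P z)) v ≡⟨ cong (λ c → unswitch S₁ (P z) c v) (Q-Pz N₁ a₁) ⟩
      unswitch S₁ (P z) z v                ≡⟨ unswitch-cong {S = S₁} {S₂} same (P z) z v ⟩
      unswitch S₂ (P z) z v                ≡⟨ cong (λ c → unswitch S₂ (P z) c v) (Q-Pz N₂ a₂) ⟨
      unswitch S₂ (P z) (partner N₂ (P z)) v ≡⟨ S.partner-unswitch N₂ a₂ j v ⟨
      partner N₂ v                         ∎
      where
      open ≡-Reasoning
      S₁ = extension N₁ a₁ (suc i)
      S₂ = extension N₂ a₂ (suc j)

    extend : AgreeingMatchings (r !) L → AgreeingMatchings (suc r !) (z ∷ L)
    extend ((F , F-injective) , F-agrees) = (G ∘ split , G∘split-injective) , G∘split-agrees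
      where
      split : Fin (suc r * r !) → Fin (suc r) × Fin (r !)
      split = remQuot (r !)

      G : Fin (suc r) × Fin (r !) → PerfectMatching K
      G (i , l) = extension (F l) (F-agrees l) i

      G∘split-agrees : ∀ x → AgreesOutside (z ∷ L) (G (split x))
      G∘split-agrees x = extension-agrees (F (proj₂ (split x))) (F-agrees (proj₂ (split x))) (proj₁ (split x))

      G-injective : ∀ p q → SameMatching (G p) (G q) → p ≡ q
      G-injective (i , l) (j , m) same
        with refl ← F-injective l m (extension-base (F l) (F-agrees l) (F m) (F-agrees m) i j same)
        = cong (_, l) (extension-injective (F l) (F-agrees l) i j same)

      G∘split-injective : ∀ x y → SameMatching (G (split x)) (G (split y)) → x ≡ y
      G∘split-injective x y same = begin
        x                         ≡⟨ combine-remQuot {suc r} (r !) x ⟨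
        uncurry combine (split x) ≡⟨ cong (uncurry combine) (G-injective (split x) (split y) same) ⟩
        uncurry combine (split y) ≡⟨ combine-remQuot {suc r} (r !) y ⟩
        y                         ∎
        where open ≡-Reasoning

  agreeingMatchings : ∀ {t} L → LightEdges t L → ∀ r → r + t ≤ length L → AgreeingMatchings (r !) L
  agreeingMatchings _ _ 0 _ = ((λ _ → M) , λ { zero zero _ → refl }) , λ _ _ _ _ → refl
  agreeingMatchings (z ∷ L) E (suc r) (s≤s r+t≤) =
    Step.extend (Unique[x∷xs]⇒x∉xs unique) (partner∉ (here refl) ∘ there) (light (here refl))
                (AllPairs.tail unique) r+t≤ (agreeingMatchings L (LightEdges-tail E) r r+t≤)
    where open LightEdges E

-- Arithmetic

2*nC2+n≡n*n : ∀ n → 2 * (n C 2) + n ≡ n * n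
2*nC2+n≡n*n zero    = refl
2*nC2+n≡n*n (suc n) = begin
  2 * (suc n C 2) + suc n     ≡⟨ cong (λ c → 2 * c + suc n) (nCk+nC[k+1]≡[n+1]C[k+1] n 1) ⟨
  2 * (n C 1 + n C 2) + suc n ≡⟨ cong (λ c → 2 * (c + n C 2) + suc n) (nC1≡n n) ⟩
  2 * (n + n C 2) + suc n     ≡⟨ regroup n (n C 2) ⟩
  2 * (n C 2) + n + (n + suc n) ≡⟨ cong (_+ (n + suc n)) (2*nC2+n≡n*n n) ⟩
  n * n + (n + suc n)         ≡⟨ square n ⟩
  suc n * suc n               ∎
  where
  open ≡-Reasoning
  regroup : ∀ n c → 2 * (n + c) + suc n ≡ 2 * c + n + (n + suc n)
  regroup = solve-∀
  square : ∀ n → n * n + (n + suc n) ≡ suc n * suc n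
  square = solve-∀

200*m≤p*p : ∀ {p m} → 100 * m ≤ p C 2 → 200 * m ≤ p * p
200*m≤p*p {p} {m} 100m≤C = begin
  200 * m             ≡⟨ *-assoc 2 100 m ⟩
  2 * (100 * m)       ≤⟨ *-monoʳ-≤ 2 100m≤C ⟩
  2 * (p C 2)         ≤⟨ m≤m+n (2 * (p C 2)) p ⟩
  2 * (p C 2) + p     ≡⟨ 2*nC2+n≡n*n p ⟩
  p * p               ∎
  where open ≤-Reasoning

n≤10*[1+n/10] : ∀ p → p ≤ 10 * suc (p / 10)
n≤10*[1+n/10] p = begin
  p                         ≡⟨ m≡m%n+[m/n]*n p 10 ⟩
  p % 10 + p / 10 * 10      ≤⟨ +-monoˡ-≤ (p / 10 * 10) (<⇒≤ (m%n<n p 10)) ⟩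
  10 + p / 10 * 10          ≡⟨ cong (10 +_) (*-comm (p / 10) 10) ⟩
  10 + 10 * (p / 10)        ≡⟨ *-suc 10 (p / 10) ⟨
  10 * suc (p / 10)         ∎
  where open ≤-Reasoning

100*h≤10*p+2000 : ∀ {p t m h} → .{{NonZero p}} → p ≤ 10 * suc t → 200 * m ≤ p * p →
                  h * suc t ≤ m + m + 2 * p → 100 * h ≤ 10 * p + 2000
100*h≤10*p+2000 {p} {t} {m} {h} p≤10[1+t] 200m≤p² h[1+t]≤ = *-cancelʳ-≤ (100 * h) (10 * p + 2000) p (begin
  100 * h * p               ≤⟨ *-monoʳ-≤ (100 * h) p≤10[1+t] ⟩
  100 * h * (10 * suc t)    ≡⟨ lemma₁ h (suc t) ⟩
  1000 * (h * suc t)        ≤⟨ *-monoʳ-≤ 1000 h[1+t]≤ ⟩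
  1000 * (m + m + 2 * p)    ≡⟨ lemma₂ m p ⟩
  10 * (200 * m) + 2000 * p ≤⟨ +-monoˡ-≤ (2000 * p) (*-monoʳ-≤ 10 200m≤p²) ⟩
  10 * (p * p) + 2000 * p   ≡⟨ lemma₃ p ⟩
  (10 * p + 2000) * p       ∎)
  where
  open ≤-Reasoning
  lemma₁ : ∀ h s → 100 * h * (10 * s) ≡ 1000 * (h * s)
  lemma₁ = solve-∀
  lemma₂ : ∀ m p → 1000 * (m + m + 2 * p) ≡ 10 * (200 * m) + 2000 * p
  lemma₂ = solve-∀
  lemma₃ : ∀ p → 10 * (p * p) + 2000 * p ≡ (10 * p + 2000) * p
  lemma₃ = solve-∀

ceil0447+[p/10+p/10]+[h+h]≤p : ∀ {p h} → 1000 ≤ p → 100 * h ≤ 10 * p + 2000 →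
                               ceil0447 p + (p / 10 + p / 10) + (h + h) ≤ p
ceil0447+[p/10+p/10]+[h+h]≤p {p} {h} 1000≤p 100h≤ = *-cancelˡ-≤ 1000 (begin
  1000 * (q + (t + t) + (h + h))                  ≡⟨ lemma₁ q t h ⟩
  q * 1000 + 200 * (t * 10) + 20 * (100 * h)      ≤⟨ +-mono-≤ (+-mono-≤ q*1000≤ (*-monoʳ-≤ 200 (m/n*n≤m p 10)))
                                                              (*-monoʳ-≤ 20 100h≤) ⟩
  447 * p + 999 + 200 * p + 20 * (10 * p + 2000)  ≡⟨ lemma₂ p ⟩
  847 * p + 40999                                 ≤⟨ +-monoʳ-≤ (847 * p) (≤-trans (≤ᵇ⇒≤ 40999 153000 _) (*-monoʳ-≤ 153 1000≤p)) ⟩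
  847 * p + 153 * p                               ≡⟨ lemma₃ p ⟩
  1000 * p                                        ∎)
  where
  open ≤-Reasoning
  q = ceil0447 p
  t = p / 10
  q*1000≤ : q * 1000 ≤ 447 * p + 999
  q*1000≤ = m/n*n≤m (447 * p + 999) 1000
  lemma₁ : ∀ q t h → 1000 * (q + (t + t) + (h + h)) ≡ q * 1000 + 200 * (t * 10) + 20 * (100 * h)
  lemma₁ = solve-∀
  lemma₂ : ∀ p → 447 * p + 999 + 200 * p + 20 * (10 * p + 2000) ≡ 847 * p + 40999
  lemma₂ = solve-∀
  lemma₃ : ∀ p → 847 * p + 153 * p ≡ 1000 * p
  lemma₃ = solve-∀

ceil0447+[p/10+p/10]≤ℓ : ∀ {p m h ℓ} → 1000 ≤ p → 100 * m ≤ p C 2 → h * suc (p / 10) ≤ m + m + 2 * p →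
                         p ≤ ℓ + h + h → ceil0447 p + (p / 10 + p / 10) ≤ ℓ
ceil0447+[p/10+p/10]≤ℓ {p} {m} {h} {ℓ} 1000≤p 100m≤C h-bound p≤ = +-cancelʳ-≤ (h + h) _ ℓ (begin
  ceil0447 p + (p / 10 + p / 10) + (h + h) ≤⟨ ceil0447+[p/10+p/10]+[h+h]≤p {p} {h} 1000≤p 100h≤ ⟩
  p                                        ≤⟨ p≤ ⟩
  ℓ + h + h                                ≡⟨ +-assoc ℓ h h ⟩
  ℓ + (h + h)                              ∎)
  where
  open ≤-Reasoning
  instance
    p≢0 : NonZero p
    p≢0 = >-nonZero (≤-trans (s≤s z≤n) 1000≤p)
  100h≤ : 100 * h ≤ 10 * p + 2000
  100h≤ = 100*h≤10*p+2000 {p} {p / 10} {m} {h} (n≤10*[1+n/10] p) (200*m≤p*p {p} {m} 100m≤C) h-bound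

-- Light edges in an almost complete graph

module _ {n : ℕ} {K : Graph n} (M : PerfectMatching K) where

  private
    P = partner M

  lowerEnds : List (Fin n)
  lowerEnds = filter (λ v → toℕ v <? toℕ (P v)) (allFin n)

  n≤2*length-lowerEnds : n ≤ 2 * length lowerEnds
  n≤2*length-lowerEnds = begin
    n                                       ≡⟨ length-tabulate id ⟨
    length (allFin n)                       ≡⟨ length-filter+length-filter-∁ (λ v → toℕ v <? toℕ (P v)) (allFin n) ⟨
    length lowerEnds + length upperEnds     ≤⟨ +-monoʳ-≤ (length lowerEnds) upperEnds≤lowerEnds ⟩
    length lowerEnds + length lowerEnds     ≡⟨ cong (length lowerEnds +_) (+-identityʳ _) ⟨
    2 * length lowerEnds                    ∎
    where
    open ≤-Reasoning
    upperEnds = filter (∁? (λ v → toℕ v <? toℕ (P v))) (allFin n)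
    P∈lowerEnds : ∀ {v} → v ∈ upperEnds → P v ∈ lowerEnds
    P∈lowerEnds {v} v∈ = ∈-filter⁺ (λ v → toℕ v <? toℕ (P v)) (∈-allFin (P v)) Pv<PPv
      where
      Pv<PPv : toℕ (P v) < toℕ (P (P v))
      Pv<PPv rewrite invol M v = ≤∧≢⇒< (≮⇒≥ (proj₂ (∈-filter⁻ _ {xs = allFin n} v∈))) (noFix M v ∘ toℕ-injective)
    upperEnds≤lowerEnds : length upperEnds ≤ length lowerEnds
    upperEnds≤lowerEnds = Unique-injection⇒length≤ P (partner-injective M) (filter⁺ _ (allFin⁺ n)) P∈lowerEnds

  module _ (t : ℕ) where

    heavy : List (Fin n)
    heavy = filter (λ v → ¬? (nonDegree K v ≤? t)) (allFin n)

    lightLowerEnds : List (Fin n)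
    lightLowerEnds = filter (λ v → nonDegree K v ≤? t ×-dec nonDegree K (P v) ≤? t) lowerEnds

    lightLowerEnds-lightEdges : LightEdges M (t + t) lightLowerEnds
    lightLowerEnds-lightEdges = record
      { unique   = filter⁺ _ (filter⁺ _ (allFin⁺ n))
      ; partner∉ = partner∉
      ; light    = light
      }
      where
      partner∉ : ∀ {z} → z ∈ lightLowerEnds → P z ∉ lightLowerEnds
      partner∉ {z} z∈ Pz∈ = <-asym (lower z∈) (subst (λ w → toℕ (P z) < toℕ w) (invol M z) (lower Pz∈))
        where
        lower : ∀ {v} → v ∈ lightLowerEnds → toℕ v < toℕ (P v)
        lower v∈ = proj₂ (∈-filter⁻ _ {xs = allFin n} (proj₁ (∈-filter⁻ _ {xs = lowerEnds} v∈)))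
      light : ∀ {z} → z ∈ lightLowerEnds → nonDegree K z + nonDegree K (P z) ≤ t + t
      light z∈ = let (_ , z-light , Pz-light) = ∈-filter⁻ _ {xs = lowerEnds} z∈ in +-mono-≤ z-light Pz-light

    heavy-count : {f : Fin n → Fin n} → (∀ {x y} → f x ≡ f y → x ≡ y) → ∀ {L} → Unique L →
                  length (filter (λ v → ¬? (nonDegree K (f v) ≤? t)) L) ≤ length heavy
    heavy-count {f} f-injective {L} uL = Unique-injection⇒length≤ f f-injective (filter⁺ _ uL)
      (λ v∈ → ∈-filter⁺ (λ v → ¬? (nonDegree K v ≤? t)) (∈-allFin _) (proj₂ (∈-filter⁻ _ {xs = L} v∈)))

    length-lowerEnds≤ : length lowerEnds ≤ length lightLowerEnds + length heavy + length heavy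
    length-lowerEnds≤ = ≤-trans
      (length≤filter-∩+filter-∁+filter-∁ (λ v → nonDegree K v ≤? t) (λ v → nonDegree K (P v) ≤? t) lowerEnds)
      (+-mono-≤ (+-monoʳ-≤ (length lightLowerEnds) (heavy-count id unique-lowerEnds))
                (heavy-count (partner-injective M) unique-lowerEnds))
      where
      unique-lowerEnds : Unique lowerEnds
      unique-lowerEnds = filter⁺ _ (allFin⁺ n)

    length-heavy*[1+t]≤ : length heavy * suc t ≤ missingEdges K + missingEdges K + n
    length-heavy*[1+t]≤ = ≤-trans (length-filter*≤sum _ (nonDegree K) ≰⇒> (allFin n)) (∑-nonDegree≤ K)

lemma4 : (p : ℕ) → 1000 ≤ p → (K : Graph (2 * p)) →
         100 * missingEdges K ≤ p C 2 →
         PerfectMatching K →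
         AtLeastMatchings K (ceil0447 p !)
lemma4 p 1000≤p K few-missing M =
  proj₁ (agreeingMatchings M (lightLowerEnds M t) (lightLowerEnds-lightEdges M t) (ceil0447 p) enough)
  where
  t = p / 10
  p≤lowerEnds : p ≤ length (lowerEnds M)
  p≤lowerEnds = *-cancelˡ-≤ 2 (n≤2*length-lowerEnds M)
  enough : ceil0447 p + (t + t) ≤ length (lightLowerEnds M t)
  enough = ceil0447+[p/10+p/10]≤ℓ {p} {missingEdges K} 1000≤p few-missing (length-heavy*[1+t]≤ M t)
                                  (≤-trans p≤lowerEnds (length-lowerEnds≤ M t))
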